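{- There do not exist rational numbers $a, b, c, d, e, f$ such that, for every positive integer $n$, the numbers $x_i = a i^2 + b n i + c i + d n^2 + e n + f$ for $i = 1, 2, \dots, n$ form a graceful sequence.
   Context: A sequence of integers $0 = x_1 < x_2 < \dots < x_n$ is called a graceful sequence if all pairwise differences are distinct: whenever $|x_i - x_j| = |x_p - x_q|$ with $i \neq j$ and $p \neq q$, we have $\{i,j\} = \{p,q\}$. -}

module Defs where

open import Data.Nat using (ℕ; _≤_; _<_)
open import Data.Integer as ℤ using (ℤ; +_; ∣_∣)
open import Data.Rational as ℚ using (ℚ; _/_; _+_; _*_)
open import Data.Product using (_×_; Σ)
open import Data.Sum using (_⊎_)
open import Relation.Binary.PropositionalEquality using (_≡_; _≢_)

ℤtoℚ : ℤ → ℚ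
ℤtoℚ z = z / 1

ℕtoℚ : ℕ → ℚ
ℕtoℚ m = (+ m) / 1

quadForm : (a b c d e f : ℚ) (n i : ℕ) → ℚ
quadForm a b c d e f n i =
  a * I * I + b * N * I + c * I + d * N * N + e * N + f
  where
    I = ℕtoℚ i
    N = ℕtoℚ n

IsGraceful : ℕ → (ℕ → ℤ) → Set
IsGraceful n x =
  (x 1 ≡ + 0)
  × (∀ i j → 1 ≤ i → i < j → j ≤ n → x i ℤ.< x j)
  × (∀ i j p q → 1 ≤ i → i ≤ n → 1 ≤ j → j ≤ n → 1 ≤ p → p ≤ n → 1 ≤ q → q ≤ n →
       i ≢ j → p ≢ q →
       ∣ x i ℤ.- x j ∣ ≡ ∣ x p ℤ.- x q ∣ →
       (i ≡ p × j ≡ q) ⊎ (i ≡ q × j ≡ p))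

QuadGraceful : (a b c d e f : ℚ) (n : ℕ) → Set
QuadGraceful a b c d e f n =
  Σ (ℕ → ℤ) λ y →
    (∀ i → 1 ≤ i → i ≤ n → ℤtoℚ (y i) ≡ quadForm a b c d e f n i)
    × IsGraceful n y

module Submission where

-- The gap x_q − x_p equals (q − p)(a (q + p) + b n + c), so the second
-- difference (x_q − x_p) − (x_q' − x_p') does not involve d, e, f.  Multiplied
-- by a common denominator E of a, b, c it becomes the integer
--   balance A B C n p q p' q' = A((q² − p²) − (q'² − p'²)) + (B n + C)((q − p) − (q' − p')).
-- A collision is a length n with two different pairs of distinct indices in
-- [1, n] making this integer vanish.  A collision produces two equal gaps, which
-- a graceful sequence forbids (no-collision).  Collisions always exist: for
-- A = 0 the sequence is arithmetic and n = 3 suffices (degenerate-collision);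
-- for A ≠ 0 an explicit polynomial family of four indices balances
-- (collision-identity), and its free parameter is taken so large that the
-- indices land in [1, n] (module Construction).

open import Defs
open import Data.Nat using (ℕ; _≤_)
open import Data.Rational using (ℚ)
open import Data.Product using (Σ)
open import Relation.Nullary using (¬_)

open import Data.Nat as ℕ using (zero; suc; _<_; z≤n; s≤s)
import Data.Nat.Properties as ℕP
open import Data.Integer as ℤ using (ℤ; +_; +[1+_]; -[1+_]; ∣_∣)
import Data.Integer.Properties as ℤP
open import Data.Integer.Tactic.RingSolver using (solve; solve-∀)
import Data.Integer.Solver as ℤSolver
open import Data.Rational as ℚ using (mkℚ; ↥_; ↧_; toℚᵘ)
import Data.Rational.Properties as ℚP
import Data.Rational.Solver as ℚSolver
import Data.Rational.Unnormalised as U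
import Data.Rational.Unnormalised.Properties as UP
open import Data.List using ([]; _∷_)
open import Data.Product using (_×_; _,_; proj₁; proj₂)
open import Data.Sum using (_⊎_; inj₁; inj₂; [_,_]′)
open import Data.Empty using (⊥-elim)
open import Relation.Nullary using (yes; no)
open import Relation.Binary.PropositionalEquality

ι : ℤ → ℚ
ι = ℤtoℚ

ι-toℚᵘ : ∀ z → toℚᵘ (ι z) U.≃ U.mkℚᵘ z 0
ι-toℚᵘ z = ℚP.toℚᵘ-fromℚᵘ (U.mkℚᵘ z 0)

ι-unique : ∀ {p} z → toℚᵘ p U.≃ U.mkℚᵘ z 0 → p ≡ ι z
ι-unique z h = ℚP.toℚᵘ-injective (UP.≃-trans h (UP.≃-sym (ι-toℚᵘ z)))

ι-+ : ∀ x y → ι x ℚ.+ ι y ≡ ι (x ℤ.+ y)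
ι-+ x y = ι-unique (x ℤ.+ y) (UP.≃-trans (ℚP.toℚᵘ-homo-+ (ι x) (ι y))
  (UP.≃-trans (UP.+-cong (ι-toℚᵘ x) (ι-toℚᵘ y)) (U.*≡* cross)))
  where
  cross : (x ℤ.* + 1 ℤ.+ y ℤ.* + 1) ℤ.* + 1 ≡ (x ℤ.+ y) ℤ.* + 1
  cross = solve (x ∷ y ∷ [])

ι-* : ∀ x y → ι x ℚ.* ι y ≡ ι (x ℤ.* y)
ι-* x y = ι-unique (x ℤ.* y) (UP.≃-trans (ℚP.toℚᵘ-homo-* (ι x) (ι y))
  (UP.≃-trans (UP.*-cong (ι-toℚᵘ x) (ι-toℚᵘ y)) (U.*≡* refl)))

ι-neg : ∀ x → ℚ.- ι x ≡ ι (ℤ.- x)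
ι-neg x = ι-unique (ℤ.- x) (UP.≃-trans (ℚP.toℚᵘ-homo‿- (ι x))
  (UP.≃-trans (UP.-‿cong (ι-toℚᵘ x)) (U.*≡* refl)))

ι-- : ∀ x y → ι x ℚ.- ι y ≡ ι (x ℤ.- y)
ι-- x y = trans (cong (ι x ℚ.+_) (ι-neg y)) (ι-+ x (ℤ.- y))

ι-injective : ∀ {x y} → ι x ≡ ι y → x ≡ y
ι-injective {x} {y} eq with UP.≃-trans (UP.≃-sym (ι-toℚᵘ x)) (UP.≃-trans (ℚP.toℚᵘ-cong eq) (ι-toℚᵘ y))
... | U.*≡* e = trans (sym (ℤP.*-identityʳ x)) (trans e (ℤP.*-identityʳ y))

denominator-clears : ∀ a → ι (↧ a) ℚ.* a ≡ ι (↥ a)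
denominator-clears a@(mkℚ n d _) = ι-unique n (UP.≃-trans (ℚP.toℚᵘ-homo-* (ι (↧ a)) a)
  (UP.≃-trans (UP.*-cong (ι-toℚᵘ (↧ a)) UP.≃-refl) (U.*≡* cross)))
  where
  cross : (+ suc d ℤ.* n) ℤ.* + 1 ≡ n ℤ.* + (1 ℕ.* suc d)
  cross = trans (commute (+ suc d) n) (cong (λ k → n ℤ.* + k) (sym (ℕP.*-identityˡ (suc d))))
    where
    commute : ∀ D x → (D ℤ.* x) ℤ.* + 1 ≡ x ℤ.* D
    commute = solve-∀

scale-clearing : ∀ a d k n → ι d ℚ.* a ≡ ι n → ι (d ℤ.* k) ℚ.* a ≡ ι (n ℤ.* k)
scale-clearing a d k n h = begin
  ι (d ℤ.* k) ℚ.* a    ≡⟨ cong (ℚ._* a) (ι-* d k) ⟨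
  ι d ℚ.* ι k ℚ.* a    ≡⟨ swap (ι d) (ι k) a ⟩
  ι d ℚ.* a ℚ.* ι k    ≡⟨ cong (ℚ._* ι k) h ⟩
  ι n ℚ.* ι k          ≡⟨ ι-* n k ⟩
  ι (n ℤ.* k)          ∎
  where
  open ≡-Reasoning
  open ℚSolver.+-*-Solver using (_:*_; _:=_)
  swap : ∀ x y z → x ℚ.* y ℚ.* z ≡ x ℚ.* z ℚ.* y
  swap = ℚSolver.+-*-Solver.solve 3 (λ x y z → x :* y :* z := x :* z :* y) refl

record Cleared (a b c : ℚ) : Set where
  field
    E A B C : ℤ
    E≢0 : E ≢ + 0
    Ea : ι E ℚ.* a ≡ ι A
    Eb : ι E ℚ.* b ≡ ι B
    Ec : ι E ℚ.* c ≡ ι C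

↧≢0 : ∀ a → ↧ a ≢ + 0
↧≢0 (mkℚ _ _ _) ()

*-≢0 : ∀ {x y} → x ≢ + 0 → y ≢ + 0 → x ℤ.* y ≢ + 0
*-≢0 {x} x≢0 y≢0 xy≡0 = [ x≢0 , y≢0 ]′ (ℤP.i*j≡0⇒i≡0∨j≡0 x xy≡0)

nonzero-factor : ∀ x {y} → x ≢ + 0 → x ℤ.* y ≡ + 0 → y ≡ + 0
nonzero-factor x x≢0 xy≡0 with ℤP.i*j≡0⇒i≡0∨j≡0 x xy≡0
... | inj₁ x≡0 = ⊥-elim (x≢0 x≡0)
... | inj₂ y≡0 = y≡0

clear : ∀ a b c → Cleared a b c
clear a b c = record
  { E = da ℤ.* (db ℤ.* dc)
  ; A = ↥ a ℤ.* (db ℤ.* dc)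
  ; B = ↥ b ℤ.* (da ℤ.* dc)
  ; C = ↥ c ℤ.* (da ℤ.* db)
  ; E≢0 = *-≢0 (↧≢0 a) (*-≢0 (↧≢0 b) (↧≢0 c))
  ; Ea = scale-clearing a da (db ℤ.* dc) (↥ a) (denominator-clears a)
  ; Eb = trans (cong (λ t → ι t ℚ.* b) (regroup₁ da db dc))
               (scale-clearing b db (da ℤ.* dc) (↥ b) (denominator-clears b))
  ; Ec = trans (cong (λ t → ι t ℚ.* c) (regroup₂ da db dc))
               (scale-clearing c dc (da ℤ.* db) (↥ c) (denominator-clears c))
  }
  where
  da db dc : ℤ
  da = ↧ a
  db = ↧ b
  dc = ↧ c
  regroup₁ : ∀ x y z → x ℤ.* (y ℤ.* z) ≡ y ℤ.* (x ℤ.* z)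
  regroup₁ = solve-∀
  regroup₂ : ∀ x y z → x ℤ.* (y ℤ.* z) ≡ z ℤ.* (x ℤ.* y)
  regroup₂ = solve-∀

-- For x_I = a I² + (b N + c) I + const, the "second difference"
-- (x_Q − x_P) − (x_Q' − x_P') equals this expression: the constant and
-- the terms d N² + e N + f cancel.
balance : (A B C N P Q P' Q' : ℤ) → ℤ
balance A B C N P Q P' Q' =
  A ℤ.* ((Q ℤ.* Q ℤ.- P ℤ.* P) ℤ.- (Q' ℤ.* Q' ℤ.- P' ℤ.* P'))
    ℤ.+ (B ℤ.* N ℤ.+ C) ℤ.* ((Q ℤ.- P) ℤ.- (Q' ℤ.- P'))

balanceℚ : (a b c N P Q P' Q' : ℚ) → ℚ
balanceℚ a b c N P Q P' Q' =
  a ℚ.* ((Q ℚ.* Q ℚ.- P ℚ.* P) ℚ.- (Q' ℚ.* Q' ℚ.- P' ℚ.* P'))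
    ℚ.+ (b ℚ.* N ℚ.+ c) ℚ.* ((Q ℚ.- P) ℚ.- (Q' ℚ.- P'))

ι-balance : ∀ A B C N P Q P' Q' →
  balanceℚ (ι A) (ι B) (ι C) (ι N) (ι P) (ι Q) (ι P') (ι Q') ≡ ι (balance A B C N P Q P' Q')
ι-balance A B C N P Q P' Q' = trans (cong₂ ℚ._+_ quadratic linear) (ι-+ (A ℤ.* X) (K ℤ.* Y))
  where
  X Y K : ℤ
  X = (Q ℤ.* Q ℤ.- P ℤ.* P) ℤ.- (Q' ℤ.* Q' ℤ.- P' ℤ.* P')
  Y = (Q ℤ.- P) ℤ.- (Q' ℤ.- P')
  K = B ℤ.* N ℤ.+ C
  ι-sqdiff : ∀ V W → ι V ℚ.* ι V ℚ.- ι W ℚ.* ι W ≡ ι (V ℤ.* V ℤ.- W ℤ.* W)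
  ι-sqdiff V W = trans (cong₂ ℚ._-_ (ι-* V V) (ι-* W W)) (ι-- (V ℤ.* V) (W ℤ.* W))
  quadratic : ι A ℚ.* ((ι Q ℚ.* ι Q ℚ.- ι P ℚ.* ι P) ℚ.- (ι Q' ℚ.* ι Q' ℚ.- ι P' ℚ.* ι P'))
            ≡ ι (A ℤ.* X)
  quadratic = trans (cong (ι A ℚ.*_) (trans (cong₂ ℚ._-_ (ι-sqdiff Q P) (ι-sqdiff Q' P'))
                                            (ι-- (Q ℤ.* Q ℤ.- P ℤ.* P) (Q' ℤ.* Q' ℤ.- P' ℤ.* P'))))
                    (ι-* A X)
  linear : (ι B ℚ.* ι N ℚ.+ ι C) ℚ.* ((ι Q ℚ.- ι P) ℚ.- (ι Q' ℚ.- ι P')) ≡ ι (K ℤ.* Y)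
  linear = trans (cong₂ ℚ._*_ (trans (cong (ℚ._+ ι C) (ι-* B N)) (ι-+ (B ℤ.* N) C))
                               (trans (cong₂ ℚ._-_ (ι-- Q P) (ι-- Q' P')) (ι-- (Q ℤ.- P) (Q' ℤ.- P'))))
                 (ι-* K Y)

scaled-second-difference : ∀ ε a b c d e f N P Q P' Q' →
  let x = λ I → a ℚ.* I ℚ.* I ℚ.+ b ℚ.* N ℚ.* I ℚ.+ c ℚ.* I ℚ.+ d ℚ.* N ℚ.* N ℚ.+ e ℚ.* N ℚ.+ f in
  ε ℚ.* ((x Q ℚ.- x P) ℚ.- (x Q' ℚ.- x P'))
    ≡ balanceℚ (ε ℚ.* a) (ε ℚ.* b) (ε ℚ.* c) N P Q P' Q'
scaled-second-difference = ℚSolver.+-*-Solver.solve 12 (λ ε a b c d e f N P Q P' Q' →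
  let x = λ I → a :* I :* I :+ b :* N :* I :+ c :* I :+ d :* N :* N :+ e :* N :+ f in
  ε :* ((x Q :- x P) :- (x Q' :- x P'))
    := (ε :* a) :* ((Q :* Q :- P :* P) :- (Q' :* Q' :- P' :* P'))
       :+ ((ε :* b) :* N :+ ε :* c) :* ((Q :- P) :- (Q' :- P'))) refl
  where open ℚSolver.+-*-Solver using (_:+_; _:-_; _:*_; _:=_)

InRange : ℕ → ℕ → Set
InRange n i = 1 ≤ i × i ≤ n

record Collision (A B C : ℤ) : Set where
  field
    n p q p' q' : ℕ
    p∈ : InRange n p
    q∈ : InRange n q
    p'∈ : InRange n p'
    q'∈ : InRange n q'
    q≢p : q ≢ p
    q'≢p' : q' ≢ p'
    distinct : ¬ ((q ≡ q' × p ≡ p') ⊎ (q ≡ p' × p ≡ q'))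
    balanced : balance A B C (+ n) (+ p) (+ q) (+ p') (+ q') ≡ + 0

  1≤n : 1 ≤ n
  1≤n = ℕP.≤-trans (proj₁ p∈) (proj₂ p∈)

-- A collision forces equal gaps in every integer sequence y realising the
-- family at its length: E times the second difference of y is the balance,
-- which vanishes, and E ≠ 0.
collision-equal-gaps : ∀ {a b c d e f} (cl : Cleared a b c) →
  let open Cleared cl in (col : Collision A B C) →
  let open Collision col in (y : ℕ → ℤ) →
  (∀ i → 1 ≤ i → i ≤ n → ℤtoℚ (y i) ≡ quadForm a b c d e f n i) →
  y q ℤ.- y p ≡ y q' ℤ.- y p'
collision-equal-gaps {a} {b} {c} {d} {e} {f} cl col y y≡x =
  ℤP.i-j≡0⇒i≡j (y q ℤ.- y p) (y q' ℤ.- y p') (nonzero-factor E E≢0 EΔ≡0)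
  where
  open Cleared cl
  open Collision col
  x : ℕ → ℚ
  x = quadForm a b c d e f n
  Δ : ℤ
  Δ = (y q ℤ.- y p) ℤ.- (y q' ℤ.- y p')
  bal : ℚ → ℚ → ℚ → ℚ
  bal a' b' c' = balanceℚ a' b' c' (ℕtoℚ n) (ℕtoℚ p) (ℕtoℚ q) (ℕtoℚ p') (ℕtoℚ q')

  ιΔ : ι Δ ≡ (x q ℚ.- x p) ℚ.- (x q' ℚ.- x p')
  ιΔ = begin
    ι Δ
      ≡⟨ trans (cong₂ ℚ._-_ (ι-- (y q) (y p)) (ι-- (y q') (y p'))) (ι-- (y q ℤ.- y p) (y q' ℤ.- y p')) ⟨
    (ι (y q) ℚ.- ι (y p)) ℚ.- (ι (y q') ℚ.- ι (y p'))
      ≡⟨ cong₂ ℚ._-_ (cong₂ ℚ._-_ (y≡x q (proj₁ q∈) (proj₂ q∈)) (y≡x p (proj₁ p∈) (proj₂ p∈)))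
                      (cong₂ ℚ._-_ (y≡x q' (proj₁ q'∈) (proj₂ q'∈)) (y≡x p' (proj₁ p'∈) (proj₂ p'∈))) ⟩
    (x q ℚ.- x p) ℚ.- (x q' ℚ.- x p')              ∎
    where open ≡-Reasoning

  EΔ≡0 : E ℤ.* Δ ≡ + 0
  EΔ≡0 = ι-injective (begin
    ι (E ℤ.* Δ)                                     ≡⟨ ι-* E Δ ⟨
    ι E ℚ.* ι Δ                                     ≡⟨ cong (ι E ℚ.*_) ιΔ ⟩
    ι E ℚ.* ((x q ℚ.- x p) ℚ.- (x q' ℚ.- x p'))
      ≡⟨ scaled-second-difference (ι E) a b c d e f (ℕtoℚ n) (ℕtoℚ p) (ℕtoℚ q) (ℕtoℚ p') (ℕtoℚ q') ⟩
    bal (ι E ℚ.* a) (ι E ℚ.* b) (ι E ℚ.* c)        ≡⟨ cong₂ (λ u v → bal u v (ι E ℚ.* c)) Ea Eb ⟩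
    bal (ι A) (ι B) (ι E ℚ.* c)                     ≡⟨ cong (bal (ι A) (ι B)) Ec ⟩
    bal (ι A) (ι B) (ι C)                           ≡⟨ ι-balance A B C (+ n) (+ p) (+ q) (+ p') (+ q') ⟩
    ι (balance A B C (+ n) (+ p) (+ q) (+ p') (+ q')) ≡⟨ cong ι balanced ⟩
    ι (+ 0)                                          ∎)
    where open ≡-Reasoning

no-collision : ∀ {a b c d e f} (cl : Cleared a b c) →
  ((n : ℕ) → 1 ≤ n → QuadGraceful a b c d e f n) →
  ¬ Collision (Cleared.A cl) (Cleared.B cl) (Cleared.C cl)
no-collision {d = d} {e = e} {f = f} cl graceful col with graceful (Collision.n col) (Collision.1≤n col)
... | y , y≡x , _ , _ , distinct-gaps =
  distinct (distinct-gaps q p q' p' (proj₁ q∈) (proj₂ q∈) (proj₁ p∈) (proj₂ p∈)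
              (proj₁ q'∈) (proj₂ q'∈) (proj₁ p'∈) (proj₂ p'∈) q≢p q'≢p'
              (cong ∣_∣ (collision-equal-gaps {d = d} {e = e} {f = f} cl col y y≡x)))
  where open Collision col

-- With A = 0 the sequence is an arithmetic progression, so already for n = 3
-- the gaps x₂ − x₁ and x₃ − x₂ coincide.
degenerate-collision : ∀ B C → Collision (+ 0) B C
degenerate-collision B C = record
  { n = 3 ; p = 1 ; q = 2 ; p' = 2 ; q' = 3
  ; p∈ = s≤s z≤n , s≤s z≤n
  ; q∈ = s≤s z≤n , s≤s (s≤s z≤n)
  ; p'∈ = s≤s z≤n , s≤s (s≤s z≤n)
  ; q'∈ = s≤s z≤n , ℕP.≤-refl
  ; q≢p = λ ()
  ; q'≢p' = λ ()
  ; distinct = λ { (inj₁ (() , _)) ; (inj₂ (_ , ())) }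
  ; balanced = trans (ℤP.+-identityˡ _) (ℤP.*-zeroʳ (B ℤ.* + 3 ℤ.+ C))
  }

IndexOf : ℕ → ℤ → Set
IndexOf n z = Σ ℕ λ k → + k ≡ z × InRange n k

near-centre : ∀ N z → ∣ z ℤ.- + N ∣ < N → IndexOf (2 ℕ.* N) z
near-centre N z close with ℤP.+∣i∣≡i⊎+∣i∣≡-i (z ℤ.- + N)
... | inj₁ above = N ℕ.+ ∣ d ∣ , value , ℕP.≤-trans 1≤N (ℕP.m≤m+n N ∣ d ∣) , upper
  where
  d : ℤ
  d = z ℤ.- + N
  1≤N : 1 ≤ N
  1≤N = ℕP.≤-<-trans z≤n close
  recentre : ∀ z N → N ℤ.+ (z ℤ.- N) ≡ z
  recentre = solve-∀
  value : + (N ℕ.+ ∣ d ∣) ≡ z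
  value = trans (ℤP.pos-+ N ∣ d ∣) (trans (cong (λ t → + N ℤ.+ t) above) (recentre z (+ N)))
  upper : N ℕ.+ ∣ d ∣ ≤ 2 ℕ.* N
  upper = ℕP.≤-trans (ℕP.+-monoʳ-≤ N (ℕP.<⇒≤ close))
                     (ℕP.≤-reflexive (cong (N ℕ.+_) (sym (ℕP.+-identityʳ N))))
... | inj₂ below = N ℕ.∸ ∣ d ∣ , value , ℕP.m<n⇒0<n∸m close , upper
  where
  d : ℤ
  d = z ℤ.- + N
  recentre : ∀ z N → N ℤ.- ℤ.- (z ℤ.- N) ≡ z
  recentre = solve-∀
  value : + (N ℕ.∸ ∣ d ∣) ≡ z
  value = begin
    + (N ℕ.∸ ∣ d ∣)     ≡⟨ ℤP.⊖-≥ (ℕP.<⇒≤ close) ⟨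
    N ℤ.⊖ ∣ d ∣          ≡⟨ ℤP.m-n≡m⊖n N ∣ d ∣ ⟨
    + N ℤ.- + ∣ d ∣      ≡⟨ cong (λ t → + N ℤ.- t) below ⟩
    + N ℤ.- ℤ.- d        ≡⟨ recentre z (+ N) ⟩
    z                    ∎
    where open ≡-Reasoning
  upper : N ℕ.∸ ∣ d ∣ ≤ 2 ℕ.* N
  upper = ℕP.≤-trans (ℕP.m∸n≤m N ∣ d ∣) (ℕP.m≤n*m N 2)

room : ∀ s u R l → suc (2 ℕ.* l) ≤ s → R < u → R ℕ.+ 2 ℕ.* l ℕ.* u < s ℕ.* u
room s u R l 2l<s R<u = begin-strict
  R ℕ.+ 2 ℕ.* l ℕ.* u   <⟨ ℕP.+-monoˡ-< (2 ℕ.* l ℕ.* u) R<u ⟩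
  suc (2 ℕ.* l) ℕ.* u   ≤⟨ ℕP.*-monoˡ-≤ u 2l<s ⟩
  s ℕ.* u               ∎
  where open ℕP.≤-Reasoning

dominant-sum : ∀ x y → ∣ y ∣ < ∣ x ∣ → x ℤ.+ y ≢ + 0
dominant-sum x y lt x+y≡0 = ℕP.<-irrefl (sym ∣x∣≡∣y∣) lt
  where
  ∣x∣≡∣y∣ : ∣ x ∣ ≡ ∣ y ∣
  ∣x∣≡∣y∣ = trans (cong ∣_∣ (ℤP.i-j≡0⇒i≡j x (ℤ.- y) (trans (cong (λ t → x ℤ.+ t) (ℤP.neg-involutive y)) x+y≡0)))
                  (ℤP.∣-i∣≡∣i∣ y)

double-zero : ∀ x → x ℤ.+ x ≡ + 0 → x ≡ + 0
double-zero (+ zero) _ = refl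
double-zero +[1+ _ ] ()
double-zero -[1+ _ ] ()

symmetric-points-differ : ∀ S e → e ≢ + 0 → S ℤ.+ e ≢ S ℤ.- e
symmetric-points-differ S e e≢0 eq = e≢0 (double-zero e (trans (sym (gap S e)) (ℤP.i≡j⇒i-j≡0 eq)))
  where
  gap : ∀ S e → (S ℤ.+ e) ℤ.- (S ℤ.- e) ≡ e ℤ.+ e
  gap = solve-∀

shifted-pairs-differ : ∀ c O s e e' → s ≢ + 0 →
  ((c ℤ.+ O) ℤ.- e) ℤ.+ ((c ℤ.+ O) ℤ.+ e) ≢ ((c ℤ.+ (O ℤ.+ s)) ℤ.- e') ℤ.+ ((c ℤ.+ (O ℤ.+ s)) ℤ.+ e')
shifted-pairs-differ c O s e e' s≢0 eq =
  s≢0 (double-zero s (trans (sym (gap c O s e e')) (ℤP.i≡j⇒i-j≡0 (sym eq))))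
  where
  gap : ∀ c O s e e' →
    (((c ℤ.+ (O ℤ.+ s)) ℤ.- e') ℤ.+ ((c ℤ.+ (O ℤ.+ s)) ℤ.+ e')) ℤ.- (((c ℤ.+ O) ℤ.- e) ℤ.+ ((c ℤ.+ O) ℤ.+ e))
      ≡ s ℤ.+ s
  gap = solve-∀

-- Take s = 2A²m + 1, centre c = sU,
-- offset O = sw + AmC, F = 2Aw + C and M = 2(A+B)U, and the pairs S₀ ∓ e₀,
-- S₁ ∓ e₁ with S₀ = c + O, S₁ = S₀ + s, e₀ = F + 2A + M, e₁ = F + M.  For
-- n = 2c their second difference is 4A(2AS₀ + Bn + C − s e₁), and the choice
-- of O makes 2AS₀ + Bn + C − s e₁ = C(2A²m + 1 − s) = 0.
collision-identity : ∀ A B C m w U →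
  let s = + 2 ℤ.* A ℤ.* A ℤ.* m ℤ.+ + 1
      c = s ℤ.* U
      O = s ℤ.* w ℤ.+ A ℤ.* m ℤ.* C
      F = + 2 ℤ.* A ℤ.* w ℤ.+ C
      M = + 2 ℤ.* (A ℤ.+ B) ℤ.* U
      e₀ = (F ℤ.+ + 2 ℤ.* A) ℤ.+ M
      e₁ = F ℤ.+ M
  in balance A B C (+ 2 ℤ.* c) ((c ℤ.+ O) ℤ.- e₀) ((c ℤ.+ O) ℤ.+ e₀)
       ((c ℤ.+ (O ℤ.+ s)) ℤ.- e₁) ((c ℤ.+ (O ℤ.+ s)) ℤ.+ e₁) ≡ + 0
collision-identity = ℤSolver.+-*-Solver.solve 6 (λ A B C m w U →
  let s = con (+ 2) :* A :* A :* m :+ con (+ 1)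
      c = s :* U
      O = s :* w :+ A :* m :* C
      F = con (+ 2) :* A :* w :+ C
      M = con (+ 2) :* (A :+ B) :* U
      e₀ = (F :+ con (+ 2) :* A) :+ M
      e₁ = F :+ M
      P = (c :+ O) :- e₀
      Q = (c :+ O) :+ e₀
      P' = (c :+ (O :+ s)) :- e₁
      Q' = (c :+ (O :+ s)) :+ e₁
  in A :* ((Q :* Q :- P :* P) :- (Q' :* Q' :- P' :* P'))
       :+ (B :* (con (+ 2) :* c) :+ C) :* ((Q :- P) :- (Q' :- P'))
     := con (+ 0)) refl
  where open ℤSolver.+-*-Solver using (con; _:+_; _:-_; _:*_; _:=_)

∣i∣*∣i∣≡i*i : ∀ i → + ∣ i ∣ ℤ.* + ∣ i ∣ ≡ i ℤ.* i
∣i∣*∣i∣≡i*i i with ℤP.+∣i∣≡i⊎+∣i∣≡-i i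
... | inj₁ ∣i∣≡i = cong₂ ℤ._*_ ∣i∣≡i ∣i∣≡i
... | inj₂ ∣i∣≡-i = trans (cong₂ ℤ._*_ ∣i∣≡-i ∣i∣≡-i) (neg*neg i)
  where
  neg*neg : ∀ i → ℤ.- i ℤ.* ℤ.- i ≡ i ℤ.* i
  neg*neg = solve-∀

-- Its four indices are the points of
-- collision-identity, with U = u chosen larger than every quantity that does
-- not grow with u; then all four points lie within distance su of the centre
-- c = su, hence in [1, n] for n = 2su.
module Construction (A B C : ℤ) (A≢0 : A ≢ + 0) where
  α l s R u n : ℕ
  sZ m w O F TA U c M e₀ e₁ : ℤ

  α = ∣ A ∣
  l = ∣ A ℤ.+ B ∣
  m = + l
  s = suc (2 ℕ.* (α ℕ.* α) ℕ.* l)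
  sZ = + 2 ℤ.* A ℤ.* A ℤ.* m ℤ.+ + 1
  w = + suc ∣ C ∣
  O = sZ ℤ.* w ℤ.+ A ℤ.* m ℤ.* C
  TA = + 2 ℤ.* A
  F = TA ℤ.* w ℤ.+ C
  -- R bounds everything independent of u; the part M of the half-gaps grows with u
  R = (∣ O ∣ ℕ.+ s) ℕ.+ (∣ F ∣ ℕ.+ ∣ TA ∣)
  u = suc R
  U = + u
  c = sZ ℤ.* U
  M = + 2 ℤ.* (A ℤ.+ B) ℤ.* U
  e₀ = (F ℤ.+ TA) ℤ.+ M
  e₁ = F ℤ.+ M
  n = 2 ℕ.* (s ℕ.* u)

  1≤α : 1 ≤ α
  1≤α = ℕP.n≢0⇒n>0 (λ ∣A∣≡0 → A≢0 (ℤP.∣i∣≡0⇒i≡0 ∣A∣≡0))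

  s-exact : + s ≡ sZ
  s-exact = begin
    + 1 ℤ.+ + (2 ℕ.* (α ℕ.* α) ℕ.* l)      ≡⟨ cong (λ t → + 1 ℤ.+ t) (ℤP.pos-* (2 ℕ.* (α ℕ.* α)) l) ⟩
    + 1 ℤ.+ + (2 ℕ.* (α ℕ.* α)) ℤ.* m      ≡⟨ cong (λ t → + 1 ℤ.+ t ℤ.* m) (ℤP.pos-* 2 (α ℕ.* α)) ⟩
    + 1 ℤ.+ + 2 ℤ.* + (α ℕ.* α) ℤ.* m      ≡⟨ cong (λ t → + 1 ℤ.+ + 2 ℤ.* t ℤ.* m)
                                                    (trans (ℤP.pos-* α α) (∣i∣*∣i∣≡i*i A)) ⟩
    + 1 ℤ.+ + 2 ℤ.* (A ℤ.* A) ℤ.* m        ≡⟨ reorder A m ⟩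
    sZ                                        ∎
    where
    open ≡-Reasoning
    reorder : ∀ A m → + 1 ℤ.+ + 2 ℤ.* (A ℤ.* A) ℤ.* m ≡ + 2 ℤ.* A ℤ.* A ℤ.* m ℤ.+ + 1
    reorder = solve-∀

  sZ≢0 : sZ ≢ + 0
  sZ≢0 sZ≡0 with trans s-exact sZ≡0
  ... | ()

  -- s exceeds 2|A + B|, the growth rate of the half-gaps relative to U.
  2l<s : suc (2 ℕ.* l) ≤ s
  2l<s = s≤s (ℕP.*-monoˡ-≤ l (ℕP.*-monoʳ-≤ 2 (ℕP.*-mono-≤ 1≤α 1≤α)))

  centre : + (s ℕ.* u) ≡ c
  centre = trans (ℤP.pos-* s u) (cong (ℤ._* U) s-exact)

  ∣M∣ : ∣ M ∣ ≡ 2 ℕ.* l ℕ.* u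
  ∣M∣ = trans (ℤP.abs-* (+ 2 ℤ.* (A ℤ.+ B)) U) (cong (ℕ._* u) (ℤP.abs-* (+ 2) (A ℤ.+ B)))

  index : ∀ z D → z ℤ.- c ≡ D → ∣ D ∣ < s ℕ.* u → IndexOf n z
  index z D z-c≡D close = near-centre (s ℕ.* u) z
    (subst (_< s ℕ.* u) (cong ∣_∣ (sym (trans (cong (λ t → z ℤ.- t) centre) z-c≡D))) close)

  deviation : ∀ X G → ∣ X ∣ ℕ.+ ∣ G ∣ ≤ R → ∣ X ∣ ℕ.+ ∣ G ℤ.+ M ∣ < s ℕ.* u
  deviation X G X+G≤R = begin-strict
    ∣ X ∣ ℕ.+ ∣ G ℤ.+ M ∣           ≤⟨ ℕP.+-monoʳ-≤ (∣ X ∣) (ℤP.∣i+j∣≤∣i∣+∣j∣ G M) ⟩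
    ∣ X ∣ ℕ.+ (∣ G ∣ ℕ.+ ∣ M ∣)     ≡⟨ ℕP.+-assoc (∣ X ∣) (∣ G ∣) (∣ M ∣) ⟨
    ∣ X ∣ ℕ.+ ∣ G ∣ ℕ.+ ∣ M ∣       ≤⟨ ℕP.+-monoˡ-≤ (∣ M ∣) X+G≤R ⟩
    R ℕ.+ ∣ M ∣                     ≡⟨ cong (R ℕ.+_) ∣M∣ ⟩
    R ℕ.+ 2 ℕ.* l ℕ.* u             <⟨ room s u R l 2l<s (ℕP.n<1+n R) ⟩
    s ℕ.* u                         ∎
    where open ℕP.≤-Reasoning

  point⁻ : ∀ X G → ∣ X ∣ ℕ.+ ∣ G ∣ ≤ R → IndexOf n ((c ℤ.+ X) ℤ.- (G ℤ.+ M))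
  point⁻ X G X+G≤R = index ((c ℤ.+ X) ℤ.- (G ℤ.+ M)) (X ℤ.- (G ℤ.+ M)) (recentre c X (G ℤ.+ M))
    (ℕP.≤-<-trans (ℤP.∣i-j∣≤∣i∣+∣j∣ X (G ℤ.+ M)) (deviation X G X+G≤R))
    where
    recentre : ∀ c X Y → ((c ℤ.+ X) ℤ.- Y) ℤ.- c ≡ X ℤ.- Y
    recentre = solve-∀

  point⁺ : ∀ X G → ∣ X ∣ ℕ.+ ∣ G ∣ ≤ R → IndexOf n ((c ℤ.+ X) ℤ.+ (G ℤ.+ M))
  point⁺ X G X+G≤R = index ((c ℤ.+ X) ℤ.+ (G ℤ.+ M)) (X ℤ.+ (G ℤ.+ M)) (recentre c X (G ℤ.+ M))
    (ℕP.≤-<-trans (ℤP.∣i+j∣≤∣i∣+∣j∣ X (G ℤ.+ M)) (deviation X G X+G≤R))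
    where
    recentre : ∀ c X Y → ((c ℤ.+ X) ℤ.+ Y) ℤ.- c ≡ X ℤ.+ Y
    recentre = solve-∀

  multiple-dominates : ∀ k → ∣ C ∣ < k → ∣ C ∣ < ∣ TA ℤ.* + k ∣
  multiple-dominates k ∣C∣<k = ℕP.<-≤-trans ∣C∣<k (begin
    k                    ≤⟨ ℕP.m≤n*m k (2 ℕ.* α) {{ℕ.>-nonZero (ℕP.≤-trans 1≤α (ℕP.m≤n*m α 2))}} ⟩
    2 ℕ.* α ℕ.* k        ≡⟨ cong (ℕ._* k) (ℤP.abs-* (+ 2) A) ⟨
    ∣ TA ∣ ℕ.* k         ≡⟨ ℤP.abs-* TA (+ k) ⟨
    ∣ TA ℤ.* + k ∣       ∎)
    where open ℕP.≤-Reasoning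

  -- A half-gap G + M with G = 2A·k + C is nonzero: if A + B = 0 then M = 0
  -- and 2A·k dominates C; otherwise M dominates G.
  half-gap≢0 : ∀ G k → ∣ G ∣ ≤ R → G ≡ TA ℤ.* + k ℤ.+ C → ∣ C ∣ < k → G ℤ.+ M ≢ + 0
  half-gap≢0 G k ∣G∣≤R G≡ ∣C∣<k with l ℕP.≟ 0
  ... | yes l≡0 = λ G+M≡0 → dominant-sum (TA ℤ.* + k) C (multiple-dominates k ∣C∣<k)
                              (trans (sym (trans (cong (λ t → G ℤ.+ t) M≡0) (trans (ℤP.+-identityʳ G) G≡))) G+M≡0)
    where
    M≡0 : M ≡ + 0
    M≡0 = trans (cong (λ t → + 2 ℤ.* t ℤ.* U) (ℤP.∣i∣≡0⇒i≡0 {A ℤ.+ B} l≡0)) refl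
  ... | no l≢0 = λ G+M≡0 → dominant-sum M G ∣G∣<∣M∣ (trans (ℤP.+-comm M G) G+M≡0)
    where
    ∣G∣<∣M∣ : ∣ G ∣ < ∣ M ∣
    ∣G∣<∣M∣ = begin-strict
      ∣ G ∣              ≤⟨ ∣G∣≤R ⟩
      R                  <⟨ ℕP.n<1+n R ⟩
      u                  ≤⟨ ℕP.m≤n*m u (2 ℕ.* l) {{ℕ.>-nonZero (ℕP.≤-trans (ℕP.n≢0⇒n>0 l≢0) (ℕP.m≤n*m l 2))}} ⟩
      2 ℕ.* l ℕ.* u      ≡⟨ ∣M∣ ⟨
      ∣ M ∣              ∎
      where open ℕP.≤-Reasoning

  -- Both half-gaps are nonzero, so each pair consists of distinct indices.
  e₀≢0 : e₀ ≢ + 0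
  e₀≢0 = half-gap≢0 (F ℤ.+ TA) (suc ∣ C ∣ ℕ.+ 1) F+TA≤R (regroup TA w C) (ℕP.m≤m+n (suc ∣ C ∣) 1)
    where
    F+TA≤R : ∣ F ℤ.+ TA ∣ ≤ R
    F+TA≤R = ℕP.≤-trans (ℤP.∣i+j∣≤∣i∣+∣j∣ F TA) (ℕP.m≤n+m _ (∣ O ∣ ℕ.+ s))
    regroup : ∀ T w C → (T ℤ.* w ℤ.+ C) ℤ.+ T ≡ T ℤ.* (w ℤ.+ + 1) ℤ.+ C
    regroup = solve-∀

  e₁≢0 : e₁ ≢ + 0
  e₁≢0 = half-gap≢0 F (suc ∣ C ∣) F≤R refl ℕP.≤-refl
    where
    F≤R : ∣ F ∣ ≤ R
    F≤R = ℕP.≤-trans (ℕP.m≤m+n ∣ F ∣ ∣ TA ∣) (ℕP.m≤n+m _ (∣ O ∣ ℕ.+ s))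

  bound₀ : ∣ O ∣ ℕ.+ ∣ F ℤ.+ TA ∣ ≤ R
  bound₀ = ℕP.+-mono-≤ (ℕP.m≤m+n ∣ O ∣ s) (ℤP.∣i+j∣≤∣i∣+∣j∣ F TA)

  bound₁ : ∣ O ℤ.+ sZ ∣ ℕ.+ ∣ F ∣ ≤ R
  bound₁ = ℕP.+-mono-≤ (subst (λ t → ∣ O ℤ.+ t ∣ ≤ ∣ O ∣ ℕ.+ s) s-exact (ℤP.∣i+j∣≤∣i∣+∣j∣ O (+ s)))
                       (ℕP.m≤m+n ∣ F ∣ ∣ TA ∣)

  P₀ : IndexOf n ((c ℤ.+ O) ℤ.- e₀)
  Q₀ : IndexOf n ((c ℤ.+ O) ℤ.+ e₀)
  P₁ : IndexOf n ((c ℤ.+ (O ℤ.+ sZ)) ℤ.- e₁)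
  Q₁ : IndexOf n ((c ℤ.+ (O ℤ.+ sZ)) ℤ.+ e₁)
  P₀ = point⁻ O (F ℤ.+ TA) bound₀
  Q₀ = point⁺ O (F ℤ.+ TA) bound₀
  P₁ = point⁻ (O ℤ.+ sZ) F bound₁
  Q₁ = point⁺ (O ℤ.+ sZ) F bound₁

  balance-cong : ∀ {N N' P P' Q Q' V V' W W'} → N ≡ N' → P ≡ P' → Q ≡ Q' → V ≡ V' → W ≡ W' →
    balance A B C N P Q V W ≡ balance A B C N' P' Q' V' W'
  balance-cong refl refl refl refl refl = refl

  -- The pairs have different sums 2S₀ ≠ 2S₁, so they are different, and they
  -- balance by collision-identity.
  collision : Collision A B C
  collision = record
    { n = n ; p = p ; q = q ; p' = p' ; q' = q'
    ; p∈ = proj₂ (proj₂ P₀) ; q∈ = proj₂ (proj₂ Q₀) ; p'∈ = proj₂ (proj₂ P₁) ; q'∈ = proj₂ (proj₂ Q₁)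
    ; q≢p = λ q≡p → symmetric-points-differ (c ℤ.+ O) e₀ e₀≢0 (identify Q₀ P₀ q≡p)
    ; q'≢p' = λ q'≡p' → symmetric-points-differ (c ℤ.+ (O ℤ.+ sZ)) e₁ e₁≢0 (identify Q₁ P₁ q'≡p')
    ; distinct = λ
        { (inj₁ (q≡q' , p≡p')) → different-sums (cong₂ ℤ._+_ (identify P₀ P₁ p≡p') (identify Q₀ Q₁ q≡q'))
        ; (inj₂ (q≡p' , p≡q')) → different-sums (trans (cong₂ ℤ._+_ (identify P₀ Q₁ p≡q') (identify Q₀ P₁ q≡p'))
                                                        (ℤP.+-comm ((c ℤ.+ (O ℤ.+ sZ)) ℤ.+ e₁) ((c ℤ.+ (O ℤ.+ sZ)) ℤ.- e₁)))
        }
    ; balanced = trans (balance-cong n≡2c (proj₁ (proj₂ P₀)) (proj₁ (proj₂ Q₀)) (proj₁ (proj₂ P₁)) (proj₁ (proj₂ Q₁)))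
                       (collision-identity A B C m w U)
    }
    where
    p q p' q' : ℕ
    p = proj₁ P₀
    q = proj₁ Q₀
    p' = proj₁ P₁
    q' = proj₁ Q₁
    identify : ∀ {z z'} (K : IndexOf n z) (K' : IndexOf n z') →
      proj₁ K ≡ proj₁ K' → z ≡ z'
    identify (k , k≡z , _) (.k , k≡z' , _) refl = trans (sym k≡z) k≡z'
    different-sums : ((c ℤ.+ O) ℤ.- e₀) ℤ.+ ((c ℤ.+ O) ℤ.+ e₀)
                   ≢ ((c ℤ.+ (O ℤ.+ sZ)) ℤ.- e₁) ℤ.+ ((c ℤ.+ (O ℤ.+ sZ)) ℤ.+ e₁)
    different-sums = shifted-pairs-differ c O sZ e₀ e₁ sZ≢0
    n≡2c : + n ≡ + 2 ℤ.* c
    n≡2c = trans (ℤP.pos-* 2 (s ℕ.* u)) (cong (+ 2 ℤ.*_) centre)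

collision-exists : ∀ A B C → Collision A B C
collision-exists A B C with A ℤ.≟ + 0
... | yes refl = degenerate-collision B C
... | no A≢0 = Construction.collision A B C A≢0

theorem3 : ¬ (Σ ℚ λ a → Σ ℚ λ b → Σ ℚ λ c → Σ ℚ λ d → Σ ℚ λ e → Σ ℚ λ f →
               ((n : ℕ) → 1 ≤ n → QuadGraceful a b c d e f n))
theorem3 (a , b , c , d , e , f , graceful) =
  no-collision {d = d} {e = e} {f = f} cleared graceful (collision-exists A B C)
  where
  cleared : Cleared a b c
  cleared = clear a b c
  open Cleared cleared using (A; B; C)
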